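{- If $a$ is a positive integer and $k\ge2$ is an integer, then \[\overline{p}_{ -k}(a\mid \text{no } 1_1\text{'s})\;\overline{p}_{ -k}(1) > \overline{p}_{ -k}(a+1\mid \text{no } 1_1\text{'s}).\]
   Context: A $k$-colored overpartition of $n$ is a partition of $n$ in which each part is assigned one of $k$ colors $1,\dots,k$, and for each pair (size, color) occurring, the last occurrence of a part of that size and color may be overlined. $\overline{p}_{ -k}(n)$ is the number of $k$-colored overpartitions of $n$, and $\overline{p}_{ -k}(n\mid \text{no } 1_1\text{'s})$ is the number of those having no non-overlined part of size $1$ and color $1$ (an overlined part $\overline{1}_1$ is allowed). -}

module Defs where

open import Data.Nat using (ℕ; zero; suc; _+_; _*_; _≟_)
open import Data.Bool using (Bool; true; false)
open import Data.Product using (_×_; _,_; proj₁)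
open import Data.List using (List; []; _∷_; concatMap; map; length; filter; upTo)
open import Data.Vec using (Vec; []; _∷_)
open import Relation.Nullary.Decidable using (⌊_⌋)

-- A k-colored overpartition of n is encoded canonically by its multiplicity data:
-- for every part size s ∈ {1,…,n} (index i : position in the outer vector, s = suc i)
-- and every color c ∈ {1,…,k} (position in the inner vector) a pair (m , b) where
--   m = number of NON-overlined parts of size s and color c,
--   b = whether the last occurrence of a part of size s and color c is overlined
--       (i.e. whether there is one additional, overlined, part s_c).
-- Parts larger than n cannot occur in an overpartition of n, so this data is
-- in bijection with k-colored overpartitions of n having weight n.
Entry : Set
Entry = ℕ × Bool

OPData : ℕ → ℕ → Set
OPData k n = Vec (Vec Entry k) n

bitℕ : Bool → ℕ
bitℕ true  = 1
bitℕ false = 0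

count : Entry → ℕ
count (m , b) = m + bitℕ b

countAll : ∀ {k} → Vec Entry k → ℕ
countAll []       = 0
countAll (e ∷ es) = count e + countAll es

weightFrom : ∀ {k n} → ℕ → OPData k n → ℕ
weightFrom s []         = 0
weightFrom s (row ∷ rs) = s * countAll row + weightFrom (suc s) rs

weight : ∀ {k n} → OPData k n → ℕ
weight = weightFrom 1

allVecs : ∀ {A : Set} → List A → (n : ℕ) → List (Vec A n)
allVecs xs zero    = [] ∷ []
allVecs xs (suc n) = concatMap (λ x → map (x ∷_) (allVecs xs n)) xs

-- candidate entries with multiplicity at most n (enough for weight n)
entries : ℕ → List Entry
entries n = concatMap (λ m → (m , false) ∷ (m , true) ∷ []) (upTo (suc n))

candidates : (k n : ℕ) → List (OPData k n)
candidates k n = allVecs (allVecs (entries n) k) n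

pbar : ℕ → ℕ → ℕ
pbar k n = length (filter (λ f → weight f ≟ n) (candidates k n))

-- "no 1_1's": no NON-overlined part of size 1 and color 1
-- (the overlined part 1̄_1 is allowed)
noOne₁ : ∀ {k n} → OPData k n → Bool
noOne₁ []                     = true
noOne₁ ([] ∷ _)               = true
noOne₁ (((m , b) ∷ _) ∷ _)    = ⌊ m ≟ 0 ⌋

pbarNo1 : ℕ → ℕ → ℕ
pbarNo1 k n = length (filter (λ f → weight f ≟ n) (filterB noOne₁ (candidates k n)))
  where
  filterB : ∀ {A : Set} → (A → Bool) → List A → List A
  filterB p [] = []
  filterB p (x ∷ xs) with p x
  ... | true  = x ∷ filterB p xs
  ... | false = filterB p xs

-- Cut one part out of an overpartition π of a + 1 without 1₁. If π has parts of size 1, cut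
-- one of them (the overlined 1̄₁ if present): it is an overpartition ν of 1, and the rest μ
-- has no 1̄₁. Otherwise cut a part s_c of size s ≥ 2, let ν be 1_c with the same overlining,
-- and pay the remaining s − 1 into μ as an overlined 1̄₁ together with s − 2 parts 1₂: the
-- 1̄₁ flags this case and the 1₂'s record s. Gluing (μ , ν) back therefore reaches every π,
-- while (a parts 1₂ , 1₁) glues to an overpartition containing 1₁. The colour 2 needs k ≥ 2.

module Submission where

open import Defs
open import Data.Nat using (ℕ; zero; suc; _+_; _*_; _<_; _≤_; _≟_; z≤n; s≤s)
open import Data.Nat.Properties
  using (+-identityʳ; +-assoc; 0≢1+n; +-suc; *-suc; *-zeroʳ; *-identityˡ; +-comm; suc-injective;
         ≤-trans; ≤-reflexive; <⇒≱; m≤m+n; m≤n+m; m≤n*m; m≤m*n; m<m+n; module ≤-Reasoning)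
open import Data.Nat.Tactic.RingSolver using (solve-∀)
open import Data.Bool using (Bool; true; false; T)
open import Data.Empty using (⊥-elim)
open import Data.Fin using (Fin; zero; suc)
open import Data.Product using (_×_; _,_; proj₂; ∃-syntax)
open import Data.List
  using (List; []; _∷_; length; map; filter; filterᵇ; concatMap; cartesianProductWith; cartesianProduct; upTo; _++_)
open import Data.List.Properties using (length-++; length-map; length-removeAt′)
open import Data.List.Membership.Propositional using (_∈_; _∉_)
open import Data.List.Membership.Propositional.Properties
  using (∈-map⁺; ∈-filter⁺; ∈-filter⁻; ∈-upTo⁺; ∈-cartesianProductWith⁺; ∈-cartesianProduct⁺)
open import Data.List.Relation.Binary.Subset.Propositional using (_⊆_)
open import Data.List.Relation.Unary.All as All using ([]; _∷_)
open import Data.List.Relation.Unary.Any using (here; there; index; _─_)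
open import Data.List.Relation.Unary.Unique.Propositional using (Unique; []; _∷_)
open import Data.List.Relation.Unary.Unique.Propositional.Properties
  using (cartesianProductWith⁺; cartesianProduct⁺; upTo⁺; filter⁺)
open import Data.Vec using (Vec; []; _∷_; _∷ʳ_; replicate; initLast)
open import Data.Vec.Properties using (∷-injective)
open import Data.Vec.Relation.Unary.All as VecAll using ([]; _∷_)
open import Function using (_∘_)
open import Relation.Nullary using (¬_)
open import Relation.Nullary.Decidable using (T?)
open import Relation.Binary.PropositionalEquality

module _ {A : Set} where

  ∈-─ : ∀ {x y : A} {ys} (x∈ys : x ∈ ys) → y ∈ ys → y ≢ x → y ∈ (ys ─ x∈ys)
  ∈-─ (here refl) (here refl) y≢x = ⊥-elim (y≢x refl)
  ∈-─ (here refl) (there y∈ys) _   = y∈ys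
  ∈-─ (there _)   (here refl) _    = here refl
  ∈-─ (there x∈ys) (there y∈ys) y≢x = there (∈-─ x∈ys y∈ys y≢x)

  Unique-⊆⇒length≤ : ∀ {xs ys : List A} → Unique xs → xs ⊆ ys → length xs ≤ length ys
  Unique-⊆⇒length≤ [] _ = z≤n
  Unique-⊆⇒length≤ {x ∷ xs} {ys} (x∉xs ∷ u) xs⊆ys =
    subst (suc (length xs) ≤_) (sym (length-removeAt′ ys (index x∈ys)))
      (s≤s (Unique-⊆⇒length≤ u λ y∈xs →
        ∈-─ x∈ys (xs⊆ys (there y∈xs)) λ y≡x → All.lookup x∉xs y∈xs (sym y≡x)))
    where
    x∈ys : x ∈ ys
    x∈ys = xs⊆ys (here refl)

covering⇒length< : ∀ {A B : Set} (f : B → A) {xs : List A} {ys : List B} {t : B} →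
  Unique xs → (∀ {x} → x ∈ xs → ∃[ y ] y ∈ ys × f y ≡ x) →
  t ∈ ys → f t ∉ xs → length xs < length ys
covering⇒length< f {xs} {ys} {t} u cover t∈ys ft∉xs =
  subst (length xs <_) (length-map f ys) (Unique-⊆⇒length≤ (ft-fresh ∷ u) ⊆-image)
  where
  ft-fresh : All.All (f t ≢_) xs
  ft-fresh = All.tabulate λ x∈xs ft≡x → ft∉xs (subst (_∈ xs) (sym ft≡x) x∈xs)
  ⊆-image : f t ∷ xs ⊆ map f ys
  ⊆-image (here refl) = ∈-map⁺ f t∈ys
  ⊆-image (there x∈xs) with cover x∈xs
  ... | y , y∈ys , refl = ∈-map⁺ f y∈ys

length-cartesianProduct : ∀ {A B : Set} (xs : List A) (ys : List B) →
  length (cartesianProduct xs ys) ≡ length xs * length ys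
length-cartesianProduct []       ys = refl
length-cartesianProduct (x ∷ xs) ys =
  trans (length-++ (map (x ,_) ys))
        (cong₂ _+_ (length-map (x ,_) ys) (length-cartesianProduct xs ys))

concatMap-map≡cartesianProductWith : ∀ {A B C : Set} (f : A → B → C) xs ys →
  concatMap (λ x → map (f x) ys) xs ≡ cartesianProductWith f xs ys
concatMap-map≡cartesianProductWith f []       ys = refl
concatMap-map≡cartesianProductWith f (x ∷ xs) ys =
  cong (map (f x) ys ++_) (concatMap-map≡cartesianProductWith f xs ys)

module _ {A : Set} {xs : List A} where

  allVecs-unique : Unique xs → ∀ n → Unique (allVecs xs n)
  allVecs-unique u zero    = [] ∷ []
  allVecs-unique u (suc n) =
    subst Unique (sym (concatMap-map≡cartesianProductWith _∷_ xs (allVecs xs n)))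
      (cartesianProductWith⁺ _∷_ ∷-injective u (allVecs-unique u n))

  ∈-allVecs : ∀ {n} {v : Vec A n} → VecAll.All (_∈ xs) v → v ∈ allVecs xs n
  ∈-allVecs []                   = here refl
  ∈-allVecs {suc n} (x∈xs ∷ v∈) =
    subst (_ ∈_) (sym (concatMap-map≡cartesianProductWith _∷_ xs (allVecs xs n)))
      (∈-cartesianProductWith⁺ _∷_ x∈xs (∈-allVecs v∈))

entries≡cartesianProduct : ∀ n → entries n ≡ cartesianProduct (upTo (suc n)) (false ∷ true ∷ [])
entries≡cartesianProduct n = concatMap-map≡cartesianProductWith _,_ (upTo (suc n)) (false ∷ true ∷ [])

∈-entries : ∀ {n m} b → m ≤ n → (m , b) ∈ entries n
∈-entries {n} {m} b m≤n =
  subst ((m , b) ∈_) (sym (entries≡cartesianProduct n))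
    (∈-cartesianProduct⁺ (∈-upTo⁺ (s≤s m≤n)) (∈-bools b))
  where
  ∈-bools : ∀ b → b ∈ false ∷ true ∷ []
  ∈-bools false = here refl
  ∈-bools true  = there (here refl)

candidates-unique : ∀ k n → Unique (candidates k n)
candidates-unique k n = allVecs-unique (allVecs-unique entries-unique k) n
  where
  entries-unique : Unique (entries n)
  entries-unique = subst Unique (sym (entries≡cartesianProduct n))
    (cartesianProduct⁺ (upTo⁺ (suc n)) (((λ ()) ∷ []) ∷ [] ∷ []))

∈-candidates : ∀ {k n} (f : OPData k n) → weight f ≤ n → f ∈ candidates k n
∈-candidates {k} {n} f w≤n = ∈-allVecs (VecAll.map (∈-allVecs ∘ row⊆entries) (countAll-rows≤ 0 f w≤n))
  where
  row⊆entries : ∀ {j} {r : Vec Entry j} → countAll r ≤ n → VecAll.All (_∈ entries n) r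
  row⊆entries {r = []}           _ = []
  row⊆entries {r = (m , b) ∷ es} h =
    ∈-entries b (≤-trans (m≤m+n m _) (≤-trans (m≤m+n _ _) h)) ∷ row⊆entries (≤-trans (m≤n+m _ _) h)
  countAll-rows≤ : ∀ {m} s (g : OPData k m) → weightFrom (suc s) g ≤ n → VecAll.All (λ r → countAll r ≤ n) g
  countAll-rows≤ s []       _ = []
  countAll-rows≤ s (r ∷ rs) h =
    ≤-trans (m≤n*m (countAll r) (suc s)) (≤-trans (m≤m+n _ _) h)
    ∷ countAll-rows≤ (suc s) rs (≤-trans (m≤n+m _ _) h)

overpartitions : (k n : ℕ) → List (OPData k n)
overpartitions k n = filter (λ f → weight f ≟ n) (candidates k n)

noOne₁Overpartitions : (k n : ℕ) → List (OPData k n)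
noOne₁Overpartitions k n = filter (λ f → weight f ≟ n) (filterᵇ noOne₁ (candidates k n))

-- pbarNo1 filters with a where-bound function that cannot be named; it is recovered
-- as the solution of a meta once the surrounding list and filter are abstracted.
mutual
  noOne₁Filter : ∀ k n → List (OPData k n) → List (OPData k n)
  noOne₁Filter = _

  pbarNo1-unfold : ∀ k n →
    pbarNo1 k n ≡ length (filter (λ f → weight f ≟ n) (noOne₁Filter k n (candidates k n)))
  pbarNo1-unfold k n with candidates k n | filter {A = OPData k n} (λ f → weight f ≟ n)
  ... | _ | _ = refl

noOne₁Filter≡filterᵇ : ∀ k n xs → noOne₁Filter k n xs ≡ filterᵇ noOne₁ xs
noOne₁Filter≡filterᵇ k n []       = refl
noOne₁Filter≡filterᵇ k n (x ∷ xs) with noOne₁ x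
... | true  = cong (x ∷_) (noOne₁Filter≡filterᵇ k n xs)
... | false = noOne₁Filter≡filterᵇ k n xs

pbarNo1≡length : ∀ k n → pbarNo1 k n ≡ length (noOne₁Overpartitions k n)
pbarNo1≡length k n =
  trans (pbarNo1-unfold k n)
        (cong (length ∘ filter (λ f → weight f ≟ n)) (noOne₁Filter≡filterᵇ k n (candidates k n)))

∈-overpartitions⁺ : ∀ {k n} {f : OPData k n} → weight f ≡ n → f ∈ overpartitions k n
∈-overpartitions⁺ {f = f} w = ∈-filter⁺ (λ f → weight f ≟ _) (∈-candidates f (≤-reflexive w)) w

∈-noOne₁Overpartitions⁺ : ∀ {k n} {f : OPData k n} →
  weight f ≡ n → T (noOne₁ f) → f ∈ noOne₁Overpartitions k n
∈-noOne₁Overpartitions⁺ {f = f} w no =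
  ∈-filter⁺ (λ f → weight f ≟ _) (∈-filter⁺ (T? ∘ noOne₁) (∈-candidates f (≤-reflexive w)) no) w

∈-noOne₁Overpartitions⁻ : ∀ {k n} {f : OPData k n} →
  f ∈ noOne₁Overpartitions k n → weight f ≡ n × T (noOne₁ f)
∈-noOne₁Overpartitions⁻ {k} {n} f∈ =
  let f∈noOne₁ , w = ∈-filter⁻ (λ f → weight f ≟ n) {xs = filterᵇ noOne₁ (candidates k n)} f∈
  in w , proj₂ (∈-filter⁻ (T? ∘ noOne₁) {xs = candidates k n} f∈noOne₁)

noOne₁Overpartitions-unique : ∀ k n → Unique (noOne₁Overpartitions k n)
noOne₁Overpartitions-unique k n = filter⁺ _ (filter⁺ _ (candidates-unique k n))

zeroRow : ∀ k → Vec Entry k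
zeroRow k = replicate k (0 , false)

-- Adding an overlined part where one is already overlined adds a plain one instead,
-- so that addPart always adds exactly one part.
addPart : ∀ {k} → Fin k → Bool → Vec Entry k → Vec Entry k
addPart zero    true  ((m , false) ∷ es) = (m , true) ∷ es
addPart zero    true  ((m , true)  ∷ es) = (suc m , true) ∷ es
addPart zero    false ((m , b)     ∷ es) = (suc m , b) ∷ es
addPart (suc c) β     (e ∷ es)           = e ∷ addPart c β es

unitRow : ∀ {k} → Fin k → Bool → Vec Entry k
unitRow {k} c β = addPart c β (zeroRow k)

countAll-zeroRow : ∀ k → countAll (zeroRow k) ≡ 0
countAll-zeroRow zero    = refl
countAll-zeroRow (suc k) = countAll-zeroRow k

countAll≡0⇒zeroRow : ∀ {k} (r : Vec Entry k) → countAll r ≡ 0 → r ≡ zeroRow k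
countAll≡0⇒zeroRow []                   _  = refl
countAll≡0⇒zeroRow ((zero , false) ∷ es) eq = cong ((0 , false) ∷_) (countAll≡0⇒zeroRow es eq)

countAll-addPart : ∀ {k} (c : Fin k) β r → countAll (addPart c β r) ≡ suc (countAll r)
countAll-addPart zero    true  ((m , false) ∷ es) = cong (_+ countAll es) (+-suc m 0)
countAll-addPart zero    true  ((m , true)  ∷ es) = refl
countAll-addPart zero    false ((m , b)     ∷ es) = refl
countAll-addPart (suc c) β     (e ∷ es)           =
  trans (cong (count e +_) (countAll-addPart c β es)) (+-suc (count e) (countAll es))

data RowView : ∀ {k} → Vec Entry k → Set where
  empty : ∀ {k} → RowView (zeroRow k)
  part  : ∀ {k} (c : Fin k) (β : Bool) (r : Vec Entry k) → RowView (addPart c β r)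

rowView : ∀ {k} (r : Vec Entry k) → RowView r
rowView []                     = empty
rowView ((m , true) ∷ es)      = part zero true ((m , false) ∷ es)
rowView ((suc m , false) ∷ es) = part zero false ((m , false) ∷ es)
rowView ((zero , false) ∷ es) with rowView es
... | empty      = empty
... | part c β r = part (suc c) β ((0 , false) ∷ r)

rowView-unitRow : ∀ {k} (c : Fin k) β → rowView (unitRow c β) ≡ part c β (zeroRow k)
rowView-unitRow zero    true  = refl
rowView-unitRow zero    false = refl
rowView-unitRow (suc c) β rewrite rowView-unitRow c β = refl

partOf : ∀ {k} → Vec Entry (suc k) → Fin (suc k) × Bool
partOf r with rowView r
... | empty      = zero , false   -- junk value, never used
... | part c β _ = c , β

partOf-unitRow : ∀ {k} (c : Fin (suc k)) β → partOf (unitRow c β) ≡ (c , β)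
partOf-unitRow c β rewrite rowView-unitRow c β = refl

zeroRows : ∀ k m → OPData k m
zeroRows k m = replicate m (zeroRow k)

addPartAt : ∀ {k m} → ℕ → Fin k → Bool → OPData k m → OPData k m
addPartAt _       c β []       = []
addPartAt zero    c β (r ∷ rs) = addPart c β r ∷ rs
addPartAt (suc i) c β (r ∷ rs) = r ∷ addPartAt i c β rs

data RowsView {k} : ∀ {m} → OPData k m → Set where
  empty : ∀ {m} → RowsView (zeroRows k m)
  part  : ∀ {m} (i : ℕ) → i < m → (c : Fin k) (β : Bool) (rs : OPData k m) → RowsView (addPartAt i c β rs)

rowsView : ∀ {k m} (rs : OPData k m) → RowsView rs
rowsView []       = empty
rowsView (r ∷ rs) with rowView r
... | part c β r′ = part 0 (s≤s z≤n) c β (r′ ∷ rs)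
... | empty with rowsView rs
...   | empty                = empty
...   | part i i<m c β rs′   = part (suc i) (s≤s i<m) c β (zeroRow _ ∷ rs′)

weightFrom-zeroRows : ∀ {k} s m → weightFrom s (zeroRows k m) ≡ 0
weightFrom-zeroRows {k} s zero    = refl
weightFrom-zeroRows {k} s (suc m) rewrite countAll-zeroRow k | *-zeroʳ s = weightFrom-zeroRows (suc s) m

weightFrom-addPartAt : ∀ {k m} s i (c : Fin k) β (rs : OPData k m) → i < m →
  weightFrom s (addPartAt i c β rs) ≡ (i + s) + weightFrom s rs
weightFrom-addPartAt s zero c β (r ∷ rs) _ rewrite countAll-addPart c β r | *-suc s (countAll r) =
  +-assoc s (s * countAll r) (weightFrom (suc s) rs)
weightFrom-addPartAt s (suc i) c β (r ∷ rs) (s≤s i<m)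
  rewrite weightFrom-addPartAt (suc s) i c β rs i<m = rearrange (s * countAll r) i s (weightFrom (suc s) rs)
  where
  rearrange : ∀ x i s w → x + ((i + suc s) + w) ≡ (suc i + s) + (x + w)
  rearrange = solve-∀

weightFrom-∷ʳ : ∀ {k m} s (rs : OPData k m) r → weightFrom s (rs ∷ʳ r) ≡ weightFrom s rs + (m + s) * countAll r
weightFrom-∷ʳ s []        r = +-identityʳ (s * countAll r)
weightFrom-∷ʳ {m = suc m} s (r′ ∷ rs) r rewrite weightFrom-∷ʳ (suc s) rs r | +-suc m s =
  sym (+-assoc (s * countAll r′) (weightFrom (suc s) rs) _)

weight-∷ʳ-zeroRow : ∀ {k m} (rs : OPData k m) → weight (rs ∷ʳ zeroRow k) ≡ weight rs
weight-∷ʳ-zeroRow {k} {m} rs rewrite weightFrom-∷ʳ 1 rs (zeroRow k) | countAll-zeroRow k | *-zeroʳ (m + 1) =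
  +-identityʳ (weight rs)

lastRow-empty : ∀ {k m} s (rs : OPData k (suc m)) → weightFrom s rs < m + s → ∃[ rs′ ] rs ≡ rs′ ∷ʳ zeroRow k
lastRow-empty {k} {m} s rs w< with initLast rs
... | rs′ , r , refl with countAll r in eq
...   | zero  = rs′ , cong (rs′ ∷ʳ_) (countAll≡0⇒zeroRow r eq)
...   | suc j = ⊥-elim (<⇒≱ w< (begin
  m + s                                 ≤⟨ m≤m*n (m + s) (suc j) ⟩
  (m + s) * suc j                       ≤⟨ m≤n+m _ (weightFrom s rs′) ⟩
  weightFrom s rs′ + (m + s) * suc j    ≡⟨ cong (λ x → weightFrom s rs′ + (m + s) * x) eq ⟨
  weightFrom s rs′ + (m + s) * countAll r ≡⟨ weightFrom-∷ʳ s rs′ r ⟨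
  weightFrom s (rs′ ∷ʳ r)               ∎))
  where open ≤-Reasoning

weight-∷ : ∀ {k m} (r : Vec Entry k) (rs : OPData k m) → weight (r ∷ rs) ≡ countAll r + weightFrom 2 rs
weight-∷ r rs = cong (_+ weightFrom 2 rs) (*-identityˡ (countAll r))

noOne₁-∷ʳ-zeroRow : ∀ {k m} (rs : OPData (suc k) m) → noOne₁ (rs ∷ʳ zeroRow (suc k)) ≡ noOne₁ rs
noOne₁-∷ʳ-zeroRow []             = refl
noOne₁-∷ʳ-zeroRow ((_ ∷ _) ∷ _) = refl

weight-addPart : ∀ {k m} (c : Fin k) β r (rs : OPData k m) → weight (addPart c β r ∷ rs) ≡ suc (weight (r ∷ rs))
weight-addPart c β r rs rewrite countAll-addPart c β r = refl

ones₂ : ∀ {k} n → Vec Entry (2 + k)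
ones₂ {k} n = (0 , false) ∷ (n , false) ∷ zeroRow k

countAll-ones₂ : ∀ {k} n → countAll (ones₂ {k} n) ≡ n
countAll-ones₂ {k} n rewrite countAll-zeroRow k = trans (+-identityʳ (n + 0)) (+-identityʳ n)

reinsert : ∀ {k m} → OPData (2 + k) (suc m) → Fin (2 + k) × Bool → OPData (2 + k) (suc m)
reinsert (((_ , true) ∷ (i , _) ∷ _) ∷ rs) (c , β) = zeroRow _ ∷ addPartAt i c β rs
reinsert (r ∷ rs)                          (c , β) = addPart c β r ∷ rs

glue : ∀ {k n} → OPData (2 + k) n × OPData (2 + k) 1 → OPData (2 + k) (suc n)
glue (μ , ν ∷ []) = reinsert (μ ∷ʳ zeroRow _) (partOf ν)

record Cut {k m} (π : OPData (2 + k) (suc m)) : Set where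
  field
    rest          : OPData (2 + k) (suc m)
    piece         : Fin (2 + k) × Bool
    reinsert-rest : reinsert rest piece ≡ π
    weight-rest   : weight π ≡ suc (weight rest)
    noOne₁-rest   : T (noOne₁ rest)

cut : ∀ {k m n} (π : OPData (2 + k) (suc m)) → T (noOne₁ π) → weight π ≡ suc n → Cut π
cut (((zero , true) ∷ es) ∷ rs) _ _ =
  record { rest = ((0 , false) ∷ es) ∷ rs ; piece = zero , true ; reinsert-rest = refl
         ; weight-rest = weight-addPart zero true ((0 , false) ∷ es) rs ; noOne₁-rest = _ }
cut {k} {m} (((zero , false) ∷ es) ∷ rs) _ w with rowView es
... | part c β r =
  record { rest = ((0 , false) ∷ r) ∷ rs ; piece = suc c , β ; reinsert-rest = refl
         ; weight-rest = weight-addPart (suc c) β ((0 , false) ∷ r) rs ; noOne₁-rest = _ }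
... | empty with rowsView rs
...   | empty = ⊥-elim (0≢1+n (trans (sym (weightFrom-zeroRows {2 + k} 1 (suc m))) w))
...   | part i i<m c β rs′ =
  record { rest = flagged ∷ rs′ ; piece = c , β ; reinsert-rest = refl
         ; weight-rest = weight-encoded ; noOne₁-rest = _ }
  where
  flagged : Vec Entry (2 + k)
  flagged = addPart zero true (ones₂ {k} i)
  W : ℕ
  W = weightFrom 2 rs′
  countAll-flagged : countAll flagged ≡ suc i
  countAll-flagged = trans (countAll-addPart zero true (ones₂ {k} i)) (cong suc (countAll-ones₂ {k} i))
  weight-encoded : weight (zeroRow (2 + k) ∷ addPartAt i c β rs′) ≡ suc (weight (flagged ∷ rs′))
  weight-encoded = begin
    weight (zeroRow (2 + k) ∷ addPartAt i c β rs′)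
      ≡⟨ weight-∷ (zeroRow (2 + k)) (addPartAt i c β rs′) ⟩
    countAll (zeroRow (2 + k)) + weightFrom 2 (addPartAt i c β rs′)
      ≡⟨ cong₂ _+_ (countAll-zeroRow (2 + k)) (weightFrom-addPartAt 2 i c β rs′ i<m) ⟩
    (i + 2) + W                  ≡⟨ cong (_+ W) (+-comm i 2) ⟩
    suc (suc i) + W              ≡⟨ cong (λ x → suc x + W) countAll-flagged ⟨
    suc (countAll flagged + W)   ≡⟨ cong suc (weight-∷ flagged rs′) ⟨
    suc (weight (flagged ∷ rs′)) ∎
    where open ≡-Reasoning

weight-unitRow : ∀ {k} (c : Fin k) β → weight (unitRow c β ∷ []) ≡ 1
weight-unitRow {k} c β
  rewrite weight-∷ (unitRow c β) [] | countAll-addPart c β (zeroRow k) | countAll-zeroRow k = refl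

glue-covers : ∀ {k n} {π : OPData (2 + k) (suc n)} → π ∈ noOne₁Overpartitions (2 + k) (suc n) →
  ∃[ μν ] μν ∈ cartesianProduct (noOne₁Overpartitions (2 + k) n) (overpartitions (2 + k) 1) × glue μν ≡ π
glue-covers {k} {n} {π} π∈ with ∈-noOne₁Overpartitions⁻ π∈
... | wπ , noπ with cut π noπ wπ
... | record { rest = μ′ ; piece = c , β ; reinsert-rest = reinserted ; weight-rest = lighter ; noOne₁-rest = noμ′ }
  with weight-μ′ ← suc-injective (trans (sym lighter) wπ)
  with lastRow-empty 1 μ′ (subst (_< n + 1) (sym weight-μ′) (m<m+n n (s≤s z≤n)))
... | μ , refl =
  (μ , unitRow c β ∷ [])
  , ∈-cartesianProduct⁺
      (∈-noOne₁Overpartitions⁺ (trans (sym (weight-∷ʳ-zeroRow μ)) weight-μ′)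
                               (subst T (noOne₁-∷ʳ-zeroRow μ) noμ′))
      (∈-overpartitions⁺ (weight-unitRow c β))
  , trans (cong (reinsert (μ ∷ʳ zeroRow (2 + k))) (partOf-unitRow c β)) reinserted

weight-ones₂ : ∀ {k} n → weight (ones₂ {k} (suc n) ∷ zeroRows (2 + k) n) ≡ suc n
weight-ones₂ {k} n =
  trans (weight-∷ (ones₂ (suc n)) (zeroRows (2 + k) n))
        (trans (cong₂ _+_ (countAll-ones₂ {k} (suc n)) (weightFrom-zeroRows {2 + k} 2 n)) (+-identityʳ (suc n)))

missed : ∀ {k} n → OPData (2 + k) (suc n) × OPData (2 + k) 1
missed {k} n = ones₂ (suc n) ∷ zeroRows (2 + k) n , unitRow zero false ∷ []

missed∈ : ∀ {k} n → missed n ∈ cartesianProduct (noOne₁Overpartitions (2 + k) (suc n)) (overpartitions (2 + k) 1)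
missed∈ {k} n =
  ∈-cartesianProduct⁺ (∈-noOne₁Overpartitions⁺ (weight-ones₂ n) _)
                      (∈-overpartitions⁺ (weight-unitRow {2 + k} zero false))

glue-missed-has-1₁ : ∀ {k} n → ¬ T (noOne₁ (glue (missed {k} n)))
glue-missed-has-1₁ n ()

lemma6p2 : (a k : ℕ) → 1 ≤ a → 2 ≤ k →
    pbarNo1 k (a + 1) < pbarNo1 k a * pbar k 1
lemma6p2 zero    _             ()  _
lemma6p2 (suc _) (suc zero)    _   (s≤s ())
lemma6p2 (suc n) (suc (suc k)) _   _ = begin-strict
  pbarNo1 K (suc n + 1)                          ≡⟨ cong (pbarNo1 K) (+-comm (suc n) 1) ⟩
  pbarNo1 K (2 + n)                              ≡⟨ pbarNo1≡length K (2 + n) ⟩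
  length (noOne₁Overpartitions K (2 + n))        <⟨ covering⇒length< glue (noOne₁Overpartitions-unique K (2 + n))
                                                      glue-covers (missed∈ n) (glue-missed-has-1₁ {k} n ∘ glued∈⇒noOne₁) ⟩
  length (cartesianProduct Xs (overpartitions K 1)) ≡⟨ length-cartesianProduct Xs (overpartitions K 1) ⟩
  length Xs * pbar K 1                           ≡⟨ cong (_* pbar K 1) (pbarNo1≡length K (suc n)) ⟨
  pbarNo1 K (suc n) * pbar K 1                   ∎
  where
  open ≤-Reasoning
  K : ℕ
  K = 2 + k
  Xs : List (OPData K (suc n))
  Xs = noOne₁Overpartitions K (suc n)
  glued∈⇒noOne₁ : glue (missed {k} n) ∈ noOne₁Overpartitions K (2 + n) → T (noOne₁ (glue (missed {k} n)))
  glued∈⇒noOne₁ = proj₂ ∘ ∈-noOne₁Overpartitions⁻
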